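{- Let $m,n\ge 1$ and let $c:2^{[m+n+1]}\to\{1,2\}$ be a 2-coloring of $\mathbf{B}_{m+n+1}$. If $c(\{i\}^c)=c(\varnothing)$ for some $i\in[m+n+1]$, where $\{i\}^c=[m+n+1]\setminus\{i\}$, then $\mathbf{B}_{m+n+1}$ contains either a subposet isomorphic to $\mathbf{V}_{m,m}$ all of whose elements have color $1$, or a subposet isomorphic to $\mathbf{V}_{n,n}$ all of whose elements have color $2$.
   Context: The Boolean lattice $\mathbf{B}_N$ is the poset $(2^{[N]},\subseteq)$ of all subsets of $[N]$. A poset $\mathbf{Q}$ contains a poset $\mathbf{P}$ as a subposet if there is an injection $\phi$ with $x\le_{\mathbf{P}} y$ if and only if $\phi(x)\le_{\mathbf{Q}}\phi(y)$. $\mathbf{V}_{m,m}$ is the poset on elements $x,y_1,\dots,y_m,z_1,\dots,z_m$ with order generated by $x<y_1<\cdots<y_m$ and $x<z_1<\cdots<z_m$ (each $y_p$ incomparable with each $z_q$). -}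

module Defs where

open import Data.Nat using (ℕ)
open import Data.Fin using (Fin)
import Data.Fin as F
open import Data.Fin.Subset using (Subset; _⊆_)
open import Data.Empty using (⊥)
open import Data.Unit using (⊤)
open import Data.Product using (Σ; _×_)
open import Function.Definitions using (Injective)
open import Relation.Binary.PropositionalEquality using (_≡_)

-- The Boolean lattice B_N : carrier Subset N (subsets of [N] ≅ Fin N), order _⊆_.

data Colour : Set where
  colour1 colour2 : Colour

-- Elements of V_{m,m}: x (bot), y_1..y_m (left), z_1..z_m (right).
data VElt (m : ℕ) : Set where
  bot   : VElt m
  left  : Fin m → VElt m
  right : Fin m → VElt m

_≤V_ : {m : ℕ} → VElt m → VElt m → Set
bot     ≤V _       = ⊤
left i  ≤V left j  = i F.≤ j
right i ≤V right j = i F.≤ j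
_       ≤V _       = ⊥

MonoV : (N m : ℕ) → (Subset N → Colour) → Colour → Set
MonoV N m c k =
  Σ (VElt m → Subset N) λ φ →
    Injective _≡_ _≡_ φ
    × ((u v : VElt m) → u ≤V v → φ u ⊆ φ v)
    × ((u v : VElt m) → φ u ⊆ φ v → u ≤V v)
    × ((u : VElt m) → c (φ u) ≡ k)

{-# OPTIONS --safe #-}
-- Key lemma: if D > p + n, every colouring of B_D contains either a V_{n+1,n+1}
-- of colour κ or a chain of p sets of the other colour all missing a common point.  By
-- induction on p: if ∅ has the other colour, recurse in the cube above {0} and put ∅ under
-- the chain; otherwise split each of the two maximal chains through {0} and through {1} by
-- pigeonhole, which gives either the two legs of a V over ∅ or a long chain missing 1 or 0.
-- For the theorem let κ = c ∅ = c ([N] ∖ {i}).  In the cube of sets containing i we get either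
-- the V_{n,n} of the other colour or a κ-chain Y of m sets missing some a; in the cube of sets
-- containing a but not i, either that V or a κ-chain Z of m − 1 sets, which the coatom
-- [N] ∖ {i} extends.  The points i and a separate Y from Z ∪ {[N] ∖ {i}}, so together with ∅
-- they form a κ-coloured V_{m,m}.
module Submission where

open import Defs
open import Data.Nat using (ℕ; _+_; _≥_; suc)
open import Data.Fin using (Fin)
open import Data.Fin.Subset using (Subset; ⁅_⁆; ∁)
import Data.Fin.Subset as S
open import Data.Sum using (_⊎_)
open import Relation.Binary.PropositionalEquality using (_≡_)

open import Data.Nat using (zero; _≤_; s≤s)
open import Data.Nat.Properties using (+-suc; +-comm; ≤-trans; ≤-reflexive; ≰⇒>)
open import Data.Fin using (zero; suc; punchIn)
import Data.Fin as F
import Data.Fin.Properties as FinP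
open import Data.Fin.Subset using (Side; inside; outside; _⊆_; _⊈_; _⊂_; _∈_; _∉_)
open import Data.Fin.Subset.Properties
  using (⊥⊆; ∉⊥; ⊆-refl; ⊆-reflexive; ⊆-antisym; drop-∷-⊆
        ; x∈⁅x⁆; x≢y⇒x∉⁅y⁆; x∉p⇒x∈∁p; x∈∁p⇒x∉p)
open import Data.Vec using ([]; _∷_; here; there; insertAt)
open import Data.List using (List; []; _∷_; map; length; lookup; _∷ʳ_)
open import Data.List.Properties using (length-map; length-++)
open import Data.List.Membership.Propositional.Properties using (∈-lookup)
open import Data.List.Relation.Unary.All as All using (All; []; _∷_)
import Data.List.Relation.Unary.All.Properties as All
open import Data.List.Relation.Unary.AllPairs as AllPairs using (AllPairs; []; _∷_)
import Data.List.Relation.Unary.AllPairs.Properties as AllPairs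
import Data.List.Relation.Binary.Sublist.Propositional as Sublist
open Sublist using ([]; _∷_)
open import Data.List.Relation.Binary.Sublist.Propositional.Properties using (All-resp-⊆)
open import Data.Product using (∃; _×_; _,_; proj₁; proj₂)
open import Data.Sum using (inj₁; inj₂; swap)
import Data.Sum as Sum
open import Data.Unit using (tt)
open import Data.Empty using (⊥-elim)
open import Function using (_∘_)
open import Relation.Nullary using (yes; no; contradiction)
open import Relation.Binary.PropositionalEquality using (refl; sym; trans; cong; subst; _≢_)

private
  variable
    k l m N ℓ : ℕ
    A : Set

opposite : Colour → Colour
opposite colour1 = colour2
opposite colour2 = colour1

≡-or-≡-opposite : ∀ x κ → x ≡ κ ⊎ x ≡ opposite κ
≡-or-≡-opposite colour1 colour1 = inj₁ refl
≡-or-≡-opposite colour1 colour2 = inj₂ refl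
≡-or-≡-opposite colour2 colour1 = inj₂ refl
≡-or-≡-opposite colour2 colour2 = inj₁ refl

infix 4 _⊊_

-- Unlike _⊂_, which demands a witness, this form is transported by every order embedding.

_⊊_ : Subset N → Subset N → Set
p ⊊ q = p ⊆ q × q ⊈ p

⊂⇒⊊ : {p q : Subset N} → p ⊂ q → p ⊊ q
⊂⇒⊊ (p⊆q , x , x∈q , x∉p) = p⊆q , λ q⊆p → x∉p (q⊆p x∈q)

⊥⊊ : {p : Subset N} {x : Fin N} → x ∈ p → S.⊥ ⊊ p
⊥⊊ x∈p = ⊂⇒⊊ (⊥⊆ , _ , x∈p , ∉⊥)

Separates : Fin N → Fin N → Subset N → Set
Separates α β p = α ∈ p × β ∉ p

infix 4 _↪_
infixr 9 _∘↪_

record _↪_ (k N : ℕ) : Set where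
  field
    embed    : Subset k → Subset N
    mono     : ∀ {p q} → p ⊆ q → embed p ⊆ embed q
    reflects : ∀ {p q} → embed p ⊆ embed q → p ⊆ q

  embed-⊊ : ∀ {p q} → p ⊊ q → embed p ⊊ embed q
  embed-⊊ (p⊆q , q⊈p) = mono p⊆q , q⊈p ∘ reflects

open _↪_

_∘↪_ : l ↪ N → k ↪ l → k ↪ N
f ∘↪ g = record
  { embed    = embed f ∘ embed g
  ; mono     = mono f ∘ mono g
  ; reflects = reflects g ∘ reflects f
  }

insertAt-mono : ∀ {p q : Subset k} (j : Fin (suc k)) (s : Side) →
                p ⊆ q → insertAt p j s ⊆ insertAt q j s
insertAt-mono zero s p⊆q here = here
insertAt-mono zero s p⊆q (there x∈) = there (p⊆q x∈)
insertAt-mono {p = inside ∷ p} {_ ∷ q} (suc j) s p⊆q here with p⊆q here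
... | here = here
insertAt-mono {p = _ ∷ p} {_ ∷ q} (suc j) s p⊆q (there x∈) =
  there (insertAt-mono j s (drop-∷-⊆ p⊆q) x∈)

insertAt-reflects : ∀ {p q : Subset k} (j : Fin (suc k)) (s : Side) →
                    insertAt p j s ⊆ insertAt q j s → p ⊆ q
insertAt-reflects zero s h = drop-∷-⊆ h
insertAt-reflects {p = _ ∷ p} {_ ∷ q} (suc j) s h here with h here
... | here = here
insertAt-reflects {p = _ ∷ p} {_ ∷ q} (suc j) s h (there x∈) =
  there (insertAt-reflects j s (drop-∷-⊆ h) x∈)

insertAt↪ : Fin (suc k) → Side → k ↪ suc k
insertAt↪ j s = record
  { embed    = λ p → insertAt p j s
  ; mono     = insertAt-mono j s
  ; reflects = insertAt-reflects j s
  }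

∈-insertAt-inside : (p : Subset k) (j : Fin (suc k)) → j ∈ insertAt p j inside
∈-insertAt-inside p zero = here
∈-insertAt-inside (_ ∷ p) (suc j) = there (∈-insertAt-inside p j)

∉-insertAt-outside : (p : Subset k) (j : Fin (suc k)) → j ∉ insertAt p j outside
∉-insertAt-outside (_ ∷ p) (suc j) (there j∈) = ∉-insertAt-outside p j j∈

punchIn-∈-insertAt⁺ : {p : Subset k} {x : Fin k} (j : Fin (suc k)) (s : Side) →
                      x ∈ p → punchIn j x ∈ insertAt p j s
punchIn-∈-insertAt⁺ zero s x∈p = there x∈p
punchIn-∈-insertAt⁺ (suc j) s here = here
punchIn-∈-insertAt⁺ (suc j) s (there x∈p) = there (punchIn-∈-insertAt⁺ j s x∈p)

punchIn-∈-insertAt⁻ : {p : Subset k} {x : Fin k} (j : Fin (suc k)) (s : Side) →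
                      punchIn j x ∈ insertAt p j s → x ∈ p
punchIn-∈-insertAt⁻ zero s (there x∈p) = x∈p
punchIn-∈-insertAt⁻ {p = _ ∷ p} {zero} (suc j) s here = here
punchIn-∈-insertAt⁻ {p = _ ∷ p} {suc x} (suc j) s (there x∈) =
  there (punchIn-∈-insertAt⁻ j s x∈)

punchIn-∉-insertAt : {p : Subset k} {x : Fin k} (j : Fin (suc k)) (s : Side) →
                     x ∉ p → punchIn j x ∉ insertAt p j s
punchIn-∉-insertAt j s x∉p = x∉p ∘ punchIn-∈-insertAt⁻ j s

MonoV-embed : (c : Subset N → Colour) {κ : Colour} (e : k ↪ N) →
              MonoV k m (c ∘ embed e) κ → MonoV N m c κ
MonoV-embed c e (φ , injective , φ-mono , φ-reflects , coloured) =
  embed e ∘ φ ,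
  (λ eq → injective (⊆-antisym (reflects e (⊆-reflexive eq))
                               (reflects e (⊆-reflexive (sym eq))))) ,
  (λ u v → mono e ∘ φ-mono u v) ,
  (λ u v → φ-reflects u v ∘ reflects e) ,
  coloured

≤V-antisym : (u v : VElt m) → u ≤V v → v ≤V u → u ≡ v
≤V-antisym bot       bot       _   _   = refl
≤V-antisym (left i)  (left j)  i≤j j≤i = cong left (FinP.≤-antisym i≤j j≤i)
≤V-antisym (right i) (right j) i≤j j≤i = cong right (FinP.≤-antisym i≤j j≤i)
≤V-antisym bot       (left _)  _   ()
≤V-antisym bot       (right _) _   ()
≤V-antisym (left _)  bot       ()  _
≤V-antisym (right _) bot       ()  _
≤V-antisym (left _)  (right _) ()  _
≤V-antisym (right _) (left _)  ()  _

Increasing : (Fin m → Subset N) → Set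
Increasing f = ∀ {i j} → i F.< j → f i ⊊ f j

Increasing⇒mono : {f : Fin m → Subset N} → Increasing f → ∀ {i j} → i F.≤ j → f i ⊆ f j
Increasing⇒mono f↑ {i} {j} i≤j with i FinP.≟ j
... | yes refl = ⊆-refl
... | no i≢j = proj₁ (f↑ (FinP.≤∧≢⇒< i≤j i≢j))

Increasing⇒reflects : {f : Fin m → Subset N} → Increasing f → ∀ {i j} → f i ⊆ f j → i F.≤ j
Increasing⇒reflects f↑ {i} {j} fi⊆fj with i FinP.≤? j
... | yes i≤j = i≤j
... | no i≰j = ⊥-elim (proj₂ (f↑ (≰⇒> i≰j)) fi⊆fj)

index : (xs : List A) → length xs ≡ m → Fin m → A
index xs refl = lookup xs

All-index : {P : A → Set} {xs : List A} → All P xs → (eq : length xs ≡ m) → ∀ j → P (index xs eq j)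
All-index pxs refl j = All.lookup pxs (∈-lookup j)

AllPairs-lookup : {R : A → A → Set} {xs : List A} → AllPairs R xs →
                  ∀ {i j} → i F.< j → R (lookup xs i) (lookup xs j)
AllPairs-lookup (rx ∷ _) {zero} {suc j} _ = All.lookup rx (∈-lookup j)
AllPairs-lookup (_ ∷ rxs) {suc i} {suc j} (s≤s i<j) = AllPairs-lookup rxs i<j

AllPairs-index : {R : A → A → Set} {xs : List A} → AllPairs R xs → (eq : length xs ≡ m) →
                 ∀ {i j} → i F.< j → R (index xs eq i) (index xs eq j)
AllPairs-index rxs refl = AllPairs-lookup rxs

AllPairs-resp-⊇ : {R : A → A → Set} {xs ys : List A} →
                  ys Sublist.⊆ xs → AllPairs R xs → AllPairs R ys
AllPairs-resp-⊇ [] [] = []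
AllPairs-resp-⊇ (_ Sublist.∷ʳ τ) (_ ∷ rxs) = AllPairs-resp-⊇ τ rxs
AllPairs-resp-⊇ (refl ∷ τ) (rx ∷ rxs) = All-resp-⊆ τ rx ∷ AllPairs-resp-⊇ τ rxs

AllPairs-embed : (e : k ↪ N) {xs : List (Subset k)} →
                 AllPairs _⊊_ xs → AllPairs _⊊_ (map (embed e) xs)
AllPairs-embed e = AllPairs.map⁺ ∘ AllPairs.map (embed-⊊ e)

Selection : (A → Set) → ℕ → List A → Set
Selection {A} P a xs = ∃ λ (ys : List A) → ys Sublist.⊆ xs × length ys ≡ a × All P ys

pigeonhole : {P Q : A → Set} → (∀ x → P x ⊎ Q x) →
             ∀ a b xs → a + b ≤ suc (length xs) → Selection P a xs ⊎ Selection Q b xs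
pigeonhole _ zero b xs _ = inj₁ ([] , Sublist.minimum xs , refl , [])
pigeonhole _ (suc a) zero xs _ = inj₂ ([] , Sublist.minimum xs , refl , [])
pigeonhole _ (suc a) (suc b) [] (s≤s a+1+b≤0) =
  contradiction (subst (_≤ 0) (+-suc a b) a+1+b≤0) λ ()
pigeonhole P∪Q (suc a) (suc b) (x ∷ xs) (s≤s bound) with P∪Q x
... | inj₁ px with pigeonhole P∪Q a (suc b) xs bound
...   | inj₁ (ys , τ , refl , pys) = inj₁ (x ∷ ys , refl ∷ τ , refl , px ∷ pys)
...   | inj₂ (ys , τ , len , qys) = inj₂ (ys , x Sublist.∷ʳ τ , len , qys)
pigeonhole P∪Q (suc a) (suc b) (x ∷ xs) (s≤s bound) | inj₂ qx
  with pigeonhole P∪Q (suc a) b xs (subst (_≤ suc (length xs)) (+-suc a b) bound)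
...   | inj₁ (ys , τ , len , pys) = inj₁ (ys , x Sublist.∷ʳ τ , len , pys)
...   | inj₂ (ys , τ , refl , qys) = inj₂ (x ∷ ys , refl ∷ τ , refl , qx ∷ qys)

record MonoChain (N ℓ : ℕ) (c : Subset N → Colour) (κ : Colour) (P : Subset N → Set) : Set where
  constructor mkChain
  field
    sets     : List (Subset N)
    length≡  : length sets ≡ ℓ
    strict   : AllPairs _⊊_ sets
    coloured : All (λ p → c p ≡ κ) sets
    property : All P sets

open MonoChain

module _ {c : Subset N → Colour} {κ : Colour} where

  MonoChain-weaken : {P Q : Subset N → Set} → (∀ {p} → P p → Q p) →
                     MonoChain N ℓ c κ P → MonoChain N ℓ c κ Q
  MonoChain-weaken P⇒Q (mkChain xs len xs↑ cxs pxs) = mkChain xs len xs↑ cxs (All.map P⇒Q pxs)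

  MonoChain-embed : {P : Subset k → Set} {Q : Subset N → Set} (e : k ↪ N) →
                    (∀ {p} → P p → Q (embed e p)) →
                    MonoChain k ℓ (c ∘ embed e) κ P → MonoChain N ℓ c κ Q
  MonoChain-embed e P⇒Q (mkChain xs len xs↑ cxs pxs) =
    mkChain (map (embed e) xs) (trans (length-map (embed e) xs) len) (AllPairs-embed e xs↑)
            (All.map⁺ cxs) (All.map⁺ (All.map P⇒Q pxs))

  MonoChain-∷ : {P : Subset N → Set} {b : Subset N} → c b ≡ κ → P b →
                (ch : MonoChain N ℓ c κ P) → All (b ⊊_) (sets ch) → MonoChain N (suc ℓ) c κ P
  MonoChain-∷ cb pb (mkChain xs len xs↑ cxs pxs) b⊊xs =
    mkChain (_ ∷ xs) (cong suc len) (b⊊xs ∷ xs↑) (cb ∷ cxs) (pb ∷ pxs)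

  MonoChain-∷ʳ : {P : Subset N → Set} {t : Subset N} → c t ≡ κ → P t →
                 (ch : MonoChain N ℓ c κ P) → All (_⊊ t) (sets ch) → MonoChain N (suc ℓ) c κ P
  MonoChain-∷ʳ {t = t} ct pt (mkChain xs len xs↑ cxs pxs) xs⊊t =
    mkChain (xs ∷ʳ t) (trans (length-++ xs) (trans (+-comm _ 1) (cong suc len)))
            (AllPairs.++⁺ xs↑ ([] ∷ []) (All.map (_∷ []) xs⊊t))
            (All.∷ʳ⁺ cxs ct) (All.∷ʳ⁺ pxs pt)

  chain-pigeonhole : {P : Subset N → Set} (xs : List (Subset N)) → AllPairs _⊊_ xs → All P xs →
                     ∀ {a b} → a + b ≤ suc (length xs) →
                     MonoChain N a c κ P ⊎ MonoChain N b c (opposite κ) P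
  chain-pigeonhole {P} xs xs↑ pxs {a} {b} bound =
    Sum.map restrict restrict (pigeonhole (λ p → ≡-or-≡-opposite (c p) κ) a b xs bound)
    where
    restrict : ∀ {ℓ κ′} → Selection (λ p → c p ≡ κ′) ℓ xs → MonoChain N ℓ c κ′ P
    restrict (ys , τ , len , cys) = mkChain ys len (AllPairs-resp-⊇ τ xs↑) cys (All-resp-⊆ τ pxs)

MonoV-from-chains : (c : Subset N → Colour) {κ : Colour} (α β : Fin N) → c S.⊥ ≡ κ →
                    MonoChain N m c κ (Separates α β) → MonoChain N m c κ (Separates β α) →
                    MonoV N m c κ
MonoV-from-chains {N = N} {m = m} c {κ} α β c⊥ Y Z =
  φ , φ-injective , φ-mono , φ-reflects , φ-coloured
  where
  y z : Fin m → Subset N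
  y = index (sets Y) (length≡ Y)
  z = index (sets Z) (length≡ Z)

  y↑ : Increasing y
  y↑ = AllPairs-index (strict Y) (length≡ Y)
  z↑ : Increasing z
  z↑ = AllPairs-index (strict Z) (length≡ Z)

  y-sep : ∀ j → Separates α β (y j)
  y-sep = All-index (property Y) (length≡ Y)
  z-sep : ∀ j → Separates β α (z j)
  z-sep = All-index (property Z) (length≡ Z)

  φ : VElt m → Subset N
  φ bot       = S.⊥
  φ (left j)  = y j
  φ (right j) = z j

  φ-mono : ∀ u v → u ≤V v → φ u ⊆ φ v
  φ-mono bot       _         _   = ⊥⊆
  φ-mono (left i)  (left j)  i≤j = Increasing⇒mono y↑ i≤j
  φ-mono (right i) (right j) i≤j = Increasing⇒mono z↑ i≤j

  φ-reflects : ∀ u v → φ u ⊆ φ v → u ≤V v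
  φ-reflects bot       _         _ = tt
  φ-reflects (left i)  bot       h = contradiction (h (proj₁ (y-sep i))) ∉⊥
  φ-reflects (right i) bot       h = contradiction (h (proj₁ (z-sep i))) ∉⊥
  φ-reflects (left i)  (left j)  h = Increasing⇒reflects y↑ h
  φ-reflects (right i) (right j) h = Increasing⇒reflects z↑ h
  φ-reflects (left i)  (right j) h = contradiction (h (proj₁ (y-sep i))) (proj₂ (z-sep j))
  φ-reflects (right i) (left j)  h = contradiction (h (proj₁ (z-sep i))) (proj₂ (y-sep j))

  φ-injective : ∀ {u v} → φ u ≡ φ v → u ≡ v
  φ-injective {u} {v} eq =
    ≤V-antisym u v (φ-reflects u v (⊆-reflexive eq)) (φ-reflects v u (⊆-reflexive (sym eq)))

  φ-coloured : ∀ u → c (φ u) ≡ κ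
  φ-coloured bot       = c⊥
  φ-coloured (left j)  = All-index (coloured Y) (length≡ Y) j
  φ-coloured (right j) = All-index (coloured Z) (length≡ Z) j

maximalChain : (k : ℕ) → List (Subset k)
maximalChain zero    = [] ∷ []
maximalChain (suc k) = S.⊥ ∷ map (inside ∷_) (maximalChain k)

length-maximalChain : ∀ k → length (maximalChain k) ≡ suc k
length-maximalChain zero    = refl
length-maximalChain (suc k) =
  cong suc (trans (length-map (inside ∷_) (maximalChain k)) (length-maximalChain k))

maximalChain-strict : ∀ k → AllPairs _⊊_ (maximalChain k)
maximalChain-strict zero    = [] ∷ []
maximalChain-strict (suc k) =
  All.map⁺ (All.universal (λ _ → ⊥⊊ here) _) ∷
  AllPairs-embed (insertAt↪ zero inside) (maximalChain-strict k)

maximalChain-pigeonhole : ∀ {d a b} {c : Subset (2 + d) → Colour} {κ : Colour}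
                          {P : Subset (2 + d) → Set} (s t : Side) →
                          (∀ p → P (s ∷ t ∷ p)) → a + b ≤ 2 + d →
                          MonoChain (2 + d) a c κ P ⊎ MonoChain (2 + d) b c (opposite κ) P
maximalChain-pigeonhole {d} s t P-st bound =
  chain-pigeonhole (map (embed st) (maximalChain d))
    (AllPairs-embed st (maximalChain-strict d))
    (All.map⁺ (All.universal P-st (maximalChain d)))
    (subst (λ L → _ ≤ suc L) (sym length-chain) bound)
  where
  st : d ↪ 2 + d
  st = insertAt↪ zero s ∘↪ insertAt↪ zero t

  length-chain : length (map (embed st) (maximalChain d)) ≡ suc d
  length-chain = trans (length-map (embed st) (maximalChain d)) (length-maximalChain d)

V-or-chain-from-⊥ : ∀ {d a b} {κ : Colour} (c : Subset (2 + d) → Colour) →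
                    c S.⊥ ≡ κ → a + b ≤ 2 + d →
                    MonoV (2 + d) a c κ ⊎ ∃ λ x → MonoChain (2 + d) b c (opposite κ) (x ∉_)
V-or-chain-from-⊥ c c⊥ bound
  with maximalChain-pigeonhole inside outside (λ _ → here , λ { (there ()) }) bound
... | inj₂ Y = inj₂ (suc zero , MonoChain-weaken proj₂ Y)
... | inj₁ Y with maximalChain-pigeonhole outside inside (λ _ → there here , λ ()) bound
...   | inj₂ Z = inj₂ (zero , MonoChain-weaken proj₂ Z)
...   | inj₁ Z = inj₁ (MonoV-from-chains c zero (suc zero) c⊥ Y Z)

-- The spare coordinate (p + n < D) leaves a point for the empty chain to miss.
V-or-chain : ∀ {D} {κ : Colour} (p n : ℕ) → 1 + p + n ≤ D → (c : Subset D → Colour) →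
             MonoV D (suc n) c κ ⊎ ∃ λ x → MonoChain D p c (opposite κ) (x ∉_)
V-or-chain zero n (s≤s _) c = inj₂ (zero , mkChain [] refl [] [] [])
V-or-chain {κ = κ} (suc p) n (s≤s h@(s≤s p+n≤d)) c with ≡-or-≡-opposite (c S.⊥) κ
... | inj₁ c⊥ = V-or-chain-from-⊥ c c⊥ (s≤s (≤-trans (≤-reflexive n+1+p≡1+p+n) (s≤s p+n≤d)))
  where
  n+1+p≡1+p+n : n + suc p ≡ suc (p + n)
  n+1+p≡1+p+n = trans (+-suc n p) (cong suc (+-comm n p))
... | inj₂ c⊥ with V-or-chain {κ = κ} p n h (c ∘ (inside ∷_))
...   | inj₁ V = inj₁ (MonoV-embed c (insertAt↪ zero inside) V)
...   | inj₂ (x , Y) = inj₂ (suc x , MonoChain-∷ c⊥ ∉⊥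
          (MonoChain-embed (insertAt↪ zero inside) (punchIn-∉-insertAt zero inside) Y)
          (All.map⁺ (All.universal (λ _ → ⊥⊊ here) _)))

MonoV-from-coatom : ∀ {m} {κ : Colour} (c : Subset (2 + N) → Colour)
                    (i : Fin (2 + N)) (a : Fin (suc N)) (b : Fin N) →
                    c S.⊥ ≡ κ → c (∁ ⁅ i ⁆) ≡ κ →
                    MonoChain (suc N) (suc m) (c ∘ embed (insertAt↪ i inside)) κ (a ∉_) →
                    MonoChain N m (c ∘ embed (insertAt↪ i outside ∘↪ insertAt↪ a inside)) κ (b ∉_) →
                    MonoV (2 + N) (suc m) c κ
MonoV-from-coatom c i a b c⊥ cX Y Z =
  MonoV-from-chains c i (punchIn i a) c⊥
    (MonoChain-embed up (λ a∉y → ∈-insertAt-inside _ i , punchIn-∉-insertAt i inside a∉y) Y)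
    (MonoChain-∷ʳ cX (∈X (FinP.punchInᵢ≢i i a) , i∉X)
      (MonoChain-embed down (λ _ → a*∈down , ∉-insertAt-outside _ i) Z)
      (All.map⁺ (All.map down⊊X (property Z))))
  where
  up   = insertAt↪ i inside
  down = insertAt↪ i outside ∘↪ insertAt↪ a inside
  X    = ∁ ⁅ i ⁆

  a*∈down : ∀ {z} → punchIn i a ∈ embed down z
  a*∈down = punchIn-∈-insertAt⁺ i outside (∈-insertAt-inside _ a)

  ∈X : ∀ {x} → x ≢ i → x ∈ X
  ∈X = x∉p⇒x∈∁p ∘ x≢y⇒x∉⁅y⁆

  i∉X : i ∉ X
  i∉X i∈X = x∈∁p⇒x∉p i∈X (x∈⁅x⁆ i)

  -- the lift of b, missed by every set of Z, is what keeps Z strictly below X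
  down⊊X : ∀ {z} → b ∉ z → embed down z ⊊ X
  down⊊X b∉z =
    ⊂⇒⊊ ( (λ x∈ → ∈X λ { refl → ∉-insertAt-outside _ i x∈ })
        , punchIn i (punchIn a b)
        , ∈X (FinP.punchInᵢ≢i i _)
        , punchIn-∉-insertAt i outside (punchIn-∉-insertAt a inside b∉z) )

V-or-oppositeV : ∀ {N} {κ : Colour} (m n : ℕ) → 2 + m + n ≤ N →
                 (c : Subset (suc N) → Colour) (i : Fin (suc N)) →
                 c (∁ ⁅ i ⁆) ≡ opposite κ → c S.⊥ ≡ opposite κ →
                 MonoV (suc N) (suc m) c (opposite κ) ⊎ MonoV (suc N) (suc n) c κ
V-or-oppositeV {κ = κ} m n (s≤s h) c i cX c⊥
  with V-or-chain {κ = κ} (suc m) n (s≤s h) (c ∘ embed (insertAt↪ i inside))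
... | inj₁ V = inj₂ (MonoV-embed c (insertAt↪ i inside) V)
... | inj₂ (a , Y)
  with V-or-chain {κ = κ} m n h (c ∘ embed (insertAt↪ i outside ∘↪ insertAt↪ a inside))
...   | inj₁ V = inj₂ (MonoV-embed c (insertAt↪ i outside ∘↪ insertAt↪ a inside) V)
...   | inj₂ (b , Z) = inj₁ (MonoV-from-coatom c i a b c⊥ cX Y Z)

2+m+n≡m+1+n+1 : ∀ m n → 2 + m + n ≡ m + suc n + 1
2+m+n≡m+1+n+1 m n = sym (trans (+-comm (m + suc n) 1) (cong suc (+-suc m n)))

lemma3 : (m n : ℕ) → m ≥ 1 → n ≥ 1
    → (c : Subset (m + n + 1) → Colour)
    → (i : Fin (m + n + 1))
    → c (∁ ⁅ i ⁆) ≡ c S.⊥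
    → MonoV (m + n + 1) m c colour1 ⊎ MonoV (m + n + 1) n c colour2
lemma3 (suc m) (suc n) _ _ c i cX≡c⊥ with ≡-or-≡-opposite (c S.⊥) colour1
... | inj₁ c⊥ =
  V-or-oppositeV {κ = colour2} m n (≤-reflexive (2+m+n≡m+1+n+1 m n)) c i (trans cX≡c⊥ c⊥) c⊥
... | inj₂ c⊥ = swap (V-or-oppositeV {κ = colour1} n m bound c i (trans cX≡c⊥ c⊥) c⊥)
  where
  bound : 2 + n + m ≤ m + suc n + 1
  bound = ≤-reflexive (trans (cong (2 +_) (+-comm n m)) (2+m+n≡m+1+n+1 m n))
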